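{- Let $d\ge 2$ and $0\le k\le d-1$. Then $G(d,k)$ divides $m_{0,k}=\binom{d+1}{k+1}$.
   Context: Binomial coefficients satisfy $\binom{a}{b}=0$ when $0\le a<b$. Let $\delta=\lfloor d/2\rfloor$ and define, for $0\le i\le\delta$ and $0\le k\le d-1$, $m_{i,k}=\binom{d+1-i}{k+1}-\binom{i}{k+1}$. Define $G(d,k)=\gcd(m_{1,k},m_{2,k},\dots,m_{\delta,k})$. -}

module Defs where

open import Data.Nat using (ℕ; zero; suc; _+_; _∸_; _/_)
open import Data.Nat.GCD using (gcd)
open import Data.Nat.Combinatorics using (_C_)

δ : ℕ → ℕ
δ d = d / 2

-- m_{i,k} = C(d+1-i, k+1) - C(i, k+1).
-- For 0 ≤ i ≤ δ we have d+1-i > i, so the first binomial is ≥ the second and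
-- truncated subtraction on ℕ coincides with integer subtraction.
m : ℕ → ℕ → ℕ → ℕ
m d i k = ((suc d ∸ i) C suc k) ∸ (i C suc k)

gcdUpTo : ℕ → ℕ → ℕ → ℕ
gcdUpTo d zero    k = 0
gcdUpTo d (suc n) k = gcd (gcdUpTo d n k) (m d (suc n) k)

G : ℕ → ℕ → ℕ
G d k = gcdUpTo d (δ d) k

-- On 0 ≤ j ≤ d + 1 the integer mℤ j = C(d+1-j, k+1) - C(j, k+1) is a polynomial in j of
-- degree k + 1, so for k + 1 < d its d-th finite difference at 0 vanishes. That difference
-- is an integer combination of mℤ 0, …, mℤ d in which mℤ 0 has coefficient ±1, so G divides
-- mℤ 0 = C(d+1, k+1) as soon as it divides mℤ 1, …, mℤ d. It does: mℤ (d+1-j) = - mℤ j, so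
-- each of these is ± m_{i,k} for some 1 ≤ i ≤ δ, or is 0 (when j = d+1-j).
-- For k = d - 1 already m_{1,k} = 1.

module Submission where

open import Defs
open import Data.Nat as ℕ using (ℕ; zero; suc; _≤_; _<_; _∸_; z≤n; s≤s; _≤′_; ≤′-refl; ≤′-step)
import Data.Nat.Properties as ℕ
open import Data.Nat.DivMod using (m≡m%n+[m/n]*n; m%n<n)
open import Data.Nat.GCD using (gcd[m,n]∣m; gcd[m,n]∣n)
import Data.Nat.Divisibility as ℕ
open import Data.Nat.Combinatorics using (_C_; nCn≡1; k>n⇒nCk≡0; nCk+nC[k+1]≡[n+1]C[k+1])
open import Data.Integer using (ℤ; +_; 0ℤ; 1ℤ; -1ℤ; -_; _+_; _-_; _*_; _^_)
import Data.Integer.Properties as ℤ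
open import Data.Integer.Divisibility.Signed
open import Data.Integer.Tactic.RingSolver using (solve-∀)
open import Data.Sum using (_⊎_; inj₁; inj₂)
open import Relation.Nullary using (yes; no; contradiction)
open import Relation.Binary.PropositionalEquality
open ≡-Reasoning

Δ : (ℕ → ℤ) → ℕ → ℤ
Δ p j = p (suc j) - p j

Δ^ : ℕ → (ℕ → ℤ) → ℕ → ℤ
Δ^ zero    p = p
Δ^ (suc n) p = Δ (Δ^ n p)

Δ^-Δ : ∀ n p j → Δ^ n (Δ p) j ≡ Δ^ (suc n) p j
Δ^-Δ zero    p j = refl
Δ^-Δ (suc n) p j = cong₂ _-_ (Δ^-Δ n p (suc j)) (Δ^-Δ n p j)

Δ^-sub : ∀ n p q j → Δ^ n (λ i → p i - q i) j ≡ Δ^ n p j - Δ^ n q j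
Δ^-sub zero    p q j = refl
Δ^-sub (suc n) p q j = begin
  Δ^ n (λ i → p i - q i) (suc j) - Δ^ n (λ i → p i - q i) j
    ≡⟨ cong₂ _-_ (Δ^-sub n p q (suc j)) (Δ^-sub n p q j) ⟩
  (Δ^ n p (suc j) - Δ^ n q (suc j)) - (Δ^ n p j - Δ^ n q j)
    ≡⟨ interchange (Δ^ n p (suc j)) (Δ^ n q (suc j)) (Δ^ n p j) (Δ^ n q j) ⟩
  Δ^ (suc n) p j - Δ^ (suc n) q j ∎
  where
  interchange : ∀ a b c e → (a - b) - (c - e) ≡ (a - c) - (b - e)
  interchange = solve-∀

Δ^-vanish : ∀ m n p → (∀ i → Δ^ n p i ≡ 0ℤ) → ∀ j → Δ^ (m ℕ.+ n) p j ≡ 0ℤ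
Δ^-vanish zero    n p Δ^ⁿp≡0 j = Δ^ⁿp≡0 j
Δ^-vanish (suc m) n p Δ^ⁿp≡0 j =
  cong₂ _-_ (Δ^-vanish m n p Δ^ⁿp≡0 (suc j)) (Δ^-vanish m n p Δ^ⁿp≡0 j)

Δ^-reflect : ∀ n p {a j c} → j ℕ.+ (n ℕ.+ c) ≡ a →
             Δ^ n (λ i → p (a ∸ i)) j ≡ -1ℤ ^ n * Δ^ n p c
Δ^-reflect zero p {a} {j} {c} refl = begin
  p (j ℕ.+ c ∸ j) ≡⟨ cong p (ℕ.m+n∸m≡n j c) ⟩
  p c             ≡⟨ ℤ.*-identityˡ (p c) ⟨
  1ℤ * p c        ∎
Δ^-reflect (suc n) p {a} {j} {c} eq = begin
  Δ^ n p̃ (suc j) - Δ^ n p̃ j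
    ≡⟨ cong₂ _-_ (Δ^-reflect n p (trans (sym (ℕ.+-suc j (n ℕ.+ c))) eq))
                 (Δ^-reflect n p (trans (cong (j ℕ.+_) (ℕ.+-suc n c)) eq)) ⟩
  s * Δ^ n p c - s * Δ^ n p (suc c)
    ≡⟨ flip s (Δ^ n p c) (Δ^ n p (suc c)) ⟩
  -1ℤ * s * (Δ^ n p (suc c) - Δ^ n p c) ∎
  where
  p̃ : ℕ → ℤ
  p̃ i = p (a ∸ i)
  s : ℤ
  s = -1ℤ ^ n
  flip : ∀ σ x y → σ * x - σ * y ≡ -1ℤ * σ * (y - x)
  flip = solve-∀

∣Δ^⇒∣p₀ : ∀ {g} n p → (∀ j → 1 ≤ j → j ≤ n → g ∣ p j) → g ∣ Δ^ n p 0 → g ∣ p 0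
∣Δ^⇒∣p₀     zero    p _   g∣Δ^p = g∣Δ^p
∣Δ^⇒∣p₀ {g} (suc n) p g∣p g∣Δ^p =
  subst (g ∣_) (cancel (p 1) (p 0)) (∣m∣n⇒∣m-n (g∣p 1 ℕ.≤-refl (s≤s z≤n)) g∣Δp₀)
  where
  g∣Δp : ∀ j → 1 ≤ j → j ≤ n → g ∣ Δ p j
  g∣Δp j 1≤j j≤n = ∣m∣n⇒∣m-n (g∣p (suc j) (s≤s z≤n) (s≤s j≤n)) (g∣p j 1≤j (ℕ.m≤n⇒m≤1+n j≤n))
  g∣Δp₀ : g ∣ Δ p 0
  g∣Δp₀ = ∣Δ^⇒∣p₀ n (Δ p) g∣Δp (subst (g ∣_) (sym (Δ^-Δ n p 0)) g∣Δ^p)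
  cancel : ∀ x y → x - (x - y) ≡ y
  cancel = solve-∀

C[_] : ℕ → ℕ → ℤ
C[ r ] j = + (j C r)

Δ-C : ∀ r j → Δ C[ suc r ] j ≡ C[ r ] j
Δ-C r j = begin
  + (suc j C suc r) - + (j C suc r)
    ≡⟨ cong (λ t → + t - + (j C suc r)) (nCk+nC[k+1]≡[n+1]C[k+1] j r) ⟨
  + (j C r ℕ.+ j C suc r) - + (j C suc r)
    ≡⟨ cong (_- + (j C suc r)) (ℤ.pos-+ (j C r) (j C suc r)) ⟩
  + (j C r) + + (j C suc r) - + (j C suc r)
    ≡⟨ cancel (+ (j C r)) (+ (j C suc r)) ⟩
  + (j C r) ∎
  where
  cancel : ∀ x y → x + y - y ≡ x
  cancel = solve-∀

Δ^-C : ∀ n r {s} → n ℕ.+ r ≡ s → ∀ j → Δ^ n C[ s ] j ≡ C[ r ] j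
Δ^-C zero    r     refl j = refl
Δ^-C (suc n) r {s} eq   j =
  trans (cong₂ _-_ (Δ^-C n (suc r) eq′ (suc j)) (Δ^-C n (suc r) eq′ j)) (Δ-C r j)
  where
  eq′ : n ℕ.+ suc r ≡ s
  eq′ = trans (ℕ.+-suc n r) eq

Δ^-C-vanish : ∀ {n r} → r < n → ∀ j → Δ^ n C[ r ] j ≡ 0ℤ
Δ^-C-vanish {n} {r} r<n j =
  subst (λ t → Δ^ t C[ r ] j ≡ 0ℤ) (ℕ.m∸n+n≡m r<n)
        (Δ^-vanish (n ∸ suc r) (suc r) C[ r ] Δ^[1+r]C[r]≡0 j)
  where
  Δ^[1+r]C[r]≡0 : ∀ i → Δ^ (suc r) C[ r ] i ≡ 0ℤ
  Δ^[1+r]C[r]≡0 i = cong₂ _-_ (Δ^-C r 0 (ℕ.+-identityʳ r) (suc i)) (Δ^-C r 0 (ℕ.+-identityʳ r) i)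

nCk≤[1+n]Ck : ∀ n k → n C k ≤ suc n C k
nCk≤[1+n]Ck n zero    = ℕ.≤-refl
nCk≤[1+n]Ck n (suc k) =
  ℕ.≤-trans (ℕ.m≤n+m (n C suc k) (n C k)) (ℕ.≤-reflexive (nCk+nC[k+1]≡[n+1]C[k+1] n k))

C-monoˡ-≤′ : ∀ k {m n} → m ≤′ n → m C k ≤ n C k
C-monoˡ-≤′ k ≤′-refl            = ℕ.≤-refl
C-monoˡ-≤′ k (≤′-step {n} m≤′n) = ℕ.≤-trans (C-monoˡ-≤′ k m≤′n) (nCk≤[1+n]Ck n k)

C-monoˡ-≤ : ∀ k {m n} → m ≤ n → m C k ≤ n C k
C-monoˡ-≤ k m≤n = C-monoˡ-≤′ k (ℕ.≤⇒≤′ m≤n)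

gcdUpTo-∣ : ∀ d k n {i} → 1 ≤ i → i ≤ n → gcdUpTo d n k ℕ.∣ m d i k
gcdUpTo-∣ d k zero    (s≤s _) ()
gcdUpTo-∣ d k (suc n) 1≤i i≤1+n with ℕ.m≤n⇒m<n∨m≡n i≤1+n
... | inj₁ (s≤s i≤n) =
  ℕ.∣-trans (gcd[m,n]∣m (gcdUpTo d n k) (m d (suc n) k)) (gcdUpTo-∣ d k n 1≤i i≤n)
... | inj₂ refl      = gcd[m,n]∣n (gcdUpTo d n k) (m d (suc n) k)

d≡d%2+[δ+δ] : ∀ d → d ≡ d ℕ.% 2 ℕ.+ (δ d ℕ.+ δ d)
d≡d%2+[δ+δ] d = trans (m≡m%n+[m/n]*n d 2)
  (cong (d ℕ.% 2 ℕ.+_) (trans (ℕ.*-comm (δ d) 2) (cong (δ d ℕ.+_) (ℕ.+-identityʳ (δ d)))))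

δ+δ≤d : ∀ d → δ d ℕ.+ δ d ≤ d
δ+δ≤d d = ℕ.≤-trans (ℕ.m≤n+m _ (d ℕ.% 2)) (ℕ.≤-reflexive (sym (d≡d%2+[δ+δ] d)))

d≤1+δ+δ : ∀ d → d ≤ suc (δ d ℕ.+ δ d)
d≤1+δ+δ d = ℕ.≤-trans (ℕ.≤-reflexive (d≡d%2+[δ+δ] d)) (ℕ.+-monoˡ-≤ _ (ℕ.≤-pred (m%n<n d 2)))

2≤d⇒1≤δ : ∀ {d} → 2 ≤ d → 1 ≤ δ d
2≤d⇒1≤δ {d} 2≤d with δ d | d≤1+δ+δ d
... | zero  | d≤1 = contradiction d≤1 (ℕ.<⇒≱ 2≤d)
... | suc _ | _   = s≤s z≤n

m+n≡o⇒o∸m≡n : ∀ m n {o} → m ℕ.+ n ≡ o → o ∸ m ≡ n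
m+n≡o⇒o∸m≡n m n refl = ℕ.m+n∸m≡n m n

b+c≤a+a⇒b≡a : ∀ {a b c} → a ≤ b → a ≤ c → b ℕ.+ c ≤ a ℕ.+ a → b ≡ a
b+c≤a+a⇒b≡a {a} {b} {c} a≤b a≤c b+c≤a+a =
  ℕ.≤-antisym (ℕ.+-cancelʳ-≤ c b a (ℕ.≤-trans b+c≤a+a (ℕ.+-monoʳ-≤ a a≤c))) a≤b

complement-split : ∀ d {i j} → i ℕ.+ j ≡ suc d → i ≤ δ d ⊎ j ≤ δ d ⊎ i ≡ j
complement-split d {i} {j} i+j≡1+d with i ℕ.≤? δ d | j ℕ.≤? δ d
... | yes i≤δ | _       = inj₁ i≤δ
... | no _    | yes j≤δ = inj₂ (inj₁ j≤δ)
... | no i≰δ  | no j≰δ  = inj₂ (inj₂ (trans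
        (b+c≤a+a⇒b≡a (ℕ.≰⇒> i≰δ) (ℕ.≰⇒> j≰δ) i+j≤2[1+δ])
        (sym (b+c≤a+a⇒b≡a (ℕ.≰⇒> j≰δ) (ℕ.≰⇒> i≰δ)
                           (subst (_≤ 2[1+δ]) (ℕ.+-comm i j) i+j≤2[1+δ])))))
  where
  2[1+δ] : ℕ
  2[1+δ] = suc (δ d) ℕ.+ suc (δ d)
  i+j≤2[1+δ] : i ℕ.+ j ≤ 2[1+δ]
  i+j≤2[1+δ] = subst (_≤ 2[1+δ]) (sym i+j≡1+d)
    (ℕ.≤-trans (s≤s (d≤1+δ+δ d)) (ℕ.≤-reflexive (cong suc (sym (ℕ.+-suc (δ d) (δ d))))))

module _ (d k : ℕ) where

  mℤ : ℕ → ℤ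
  mℤ j = C[ suc k ] (suc d ∸ j) - C[ suc k ] j

  m≡mℤ : ∀ {i} → i ≤ suc d ∸ i → + m d i k ≡ mℤ i
  m≡mℤ {i} i≤d+1-i = sym (trans (ℤ.m-n≡m⊖n ((suc d ∸ i) C suc k) (i C suc k))
                                (ℤ.⊖-≥ (C-monoˡ-≤ (suc k) i≤d+1-i)))

  mℤ-antisym : ∀ i j → i ℕ.+ j ≡ suc d → mℤ i ≡ - mℤ j
  mℤ-antisym i j i+j≡1+d = begin
    C[ suc k ] (suc d ∸ i) - C[ suc k ] i
      ≡⟨ cong₂ (λ x y → C[ suc k ] x - C[ suc k ] y)
           (m+n≡o⇒o∸m≡n i j i+j≡1+d) (sym (m+n≡o⇒o∸m≡n j i (trans (ℕ.+-comm j i) i+j≡1+d))) ⟩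
    C[ suc k ] j - C[ suc k ] (suc d ∸ j)
      ≡⟨ swap (C[ suc k ] j) (C[ suc k ] (suc d ∸ j)) ⟩
    - mℤ j ∎
    where
    swap : ∀ x y → x - y ≡ - (y - x)
    swap = solve-∀

  G∣mℤ-low : ∀ {i} → 1 ≤ i → i ≤ δ d → + G d k ∣ mℤ i
  G∣mℤ-low {i} 1≤i i≤δ =
    subst (+ G d k ∣_) (m≡mℤ i≤d+1-i) (∣ᵤ⇒∣ (gcdUpTo-∣ d k (δ d) 1≤i i≤δ))
    where
    i≤d+1-i : i ≤ suc d ∸ i
    i≤d+1-i = ℕ.m+n≤o⇒m≤o∸n i
      (ℕ.≤-trans (ℕ.+-mono-≤ i≤δ i≤δ) (ℕ.≤-trans (δ+δ≤d d) (ℕ.n≤1+n d)))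

  G∣mℤ-complement : ∀ {i j} → 1 ≤ i → 1 ≤ j → i ℕ.+ j ≡ suc d → + G d k ∣ mℤ i
  G∣mℤ-complement {i} {j} 1≤i 1≤j i+j≡1+d with complement-split d i+j≡1+d
  ... | inj₁ i≤δ         = G∣mℤ-low 1≤i i≤δ
  ... | inj₂ (inj₁ j≤δ) =
    subst (+ G d k ∣_) (sym (mℤ-antisym i j i+j≡1+d)) (∣m⇒∣-m (G∣mℤ-low 1≤j j≤δ))
  ... | inj₂ (inj₂ refl) = subst (+ G d k ∣_) (sym mℤi≡0) (divides 0ℤ refl)
    where
    mℤi≡0 : mℤ i ≡ 0ℤ
    mℤi≡0 = trans (cong (λ x → C[ suc k ] x - C[ suc k ] i) (m+n≡o⇒o∸m≡n i j i+j≡1+d))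
                  (ℤ.+-inverseʳ (C[ suc k ] i))

  G∣mℤ : ∀ j → 1 ≤ j → j ≤ d → + G d k ∣ mℤ j
  G∣mℤ j 1≤j j≤d =
    G∣mℤ-complement 1≤j (ℕ.m<n⇒0<n∸m (s≤s j≤d)) (ℕ.m+[n∸m]≡n (ℕ.m≤n⇒m≤1+n j≤d))

  Δ^mℤ≡0 : suc k < d → Δ^ d mℤ 0 ≡ 0ℤ
  Δ^mℤ≡0 1+k<d = begin
    Δ^ d mℤ 0
      ≡⟨ Δ^-sub d (λ j → C[ suc k ] (suc d ∸ j)) C[ suc k ] 0 ⟩
    Δ^ d (λ j → C[ suc k ] (suc d ∸ j)) 0 - Δ^ d C[ suc k ] 0
      ≡⟨ cong (_- Δ^ d C[ suc k ] 0) (Δ^-reflect d C[ suc k ] (ℕ.+-comm d 1)) ⟩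
    -1ℤ ^ d * Δ^ d C[ suc k ] 1 - Δ^ d C[ suc k ] 0
      ≡⟨ cong₂ (λ x y → -1ℤ ^ d * x - y) (Δ^-C-vanish 1+k<d 1) (Δ^-C-vanish 1+k<d 0) ⟩
    -1ℤ ^ d * 0ℤ - 0ℤ
      ≡⟨ cong (_- 0ℤ) (ℤ.*-zeroʳ (-1ℤ ^ d)) ⟩
    0ℤ ∎

  mℤ₀≡C : mℤ 0 ≡ + (suc d C suc k)
  mℤ₀≡C = ℤ.+-identityʳ _

lemma3p5 : (d k : ℕ) → 2 ≤ d → k < d → G d k ℕ.∣ ((suc d) C (suc k))
lemma3p5 d k 2≤d k<d with ℕ.m≤n⇒m<n∨m≡n k<d
... | inj₁ 1+k<d = ∣⇒∣ᵤ (subst (+ G d k ∣_) (mℤ₀≡C d k) (∣Δ^⇒∣p₀ d (mℤ d k) (G∣mℤ d k) G∣Δ^mℤ))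
  where
  G∣Δ^mℤ : + G d k ∣ Δ^ d (mℤ d k) 0
  G∣Δ^mℤ = subst (+ G d k ∣_) (sym (Δ^mℤ≡0 d k 1+k<d)) (divides 0ℤ refl)
... | inj₂ refl =
  ℕ.∣-trans (subst (G d k ℕ.∣_) m₁≡1 (gcdUpTo-∣ d k (δ d) ℕ.≤-refl (2≤d⇒1≤δ 2≤d))) (ℕ.1∣ _)
  where
  m₁≡1 : m d 1 k ≡ 1
  m₁≡1 = cong₂ _∸_ (nCn≡1 d) (k>n⇒nCk≡0 2≤d)
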